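{- Let $P$ be a full program and let $t[\vec{x}]$ be a primitive recursive term in the language of $P$ whose variables are among $\vec x=x_1,\dots,x_n$. Then $\overline{\mathbf{IT}}(\mathbb{N}),\forall P\vdash \mathsf{N}(x_1)\wedge\dots\wedge\mathsf N(x_n)\Rightarrow \mathsf{N}(t[\vec{x}])$.
   Context: A program is a set $P$ of first-order equations (together with a distinguished function symbol). $\mathrm{PR}$ is the set of standard defining equations of all primitive recursive functions; a term is primitive recursive if it is in the language of $\mathrm{PR}$. $P$ is full if whenever it contains a function symbol corresponding to a primitive recursive function, it also contains all the $\mathrm{PR}$ defining equations for that function. $\forall P$ denotes the set of universal closures of the equations of $P$. The discrete intrinsic theory of natural numbers $\overline{\mathbf{IT}}(\mathbb{N})$ is the first-order theory with equality (with ordinary classical natural deduction and unrestricted quantifier rules) whose vocabulary includes $\mathsf 0$, $\mathsf S$ and a unary predicate $\mathsf N$ (here extended with the function symbols of $P$), with the separation axioms $\forall x\,\mathsf S(x)\neq\mathsf 0$, $\forall x,y\,(\mathsf S(x)=\mathsf S(y)\to x=y)$ and the rules: infer $\mathsf N(\mathsf 0)$; from $\mathsf N(t)$ infer $\mathsf N(\mathsf S t)$; from $\mathsf N(t)$, $A[\mathsf 0]$ and $\forall x\,(A[x]\to A[\mathsf S x])$ infer $A[t]$, for any formula $A$ and term $t$. -}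

module Defs where

open import Data.Nat using (ℕ; zero; suc; _⊔_; _<_)
open import Data.Fin using (Fin; toℕ)
open import Data.Vec using (Vec; []; _∷_; tabulate; map)
open import Data.List using (List; upTo) renaming (_∷_ to _∷ₗ_; map to mapₗ)
open import Data.List.Membership.Propositional using (_∈_)
open import Data.Product using (Σ; _×_; _,_)
open import Data.Sum using (_⊎_)

-- Z  : the n-ary zero function          Z(x⃗) = 0
--   Sc : successor                        Sc(x) = S x
--   Pi i : projection                     Pi_i(x⃗) = x_i
--   Cmp f g⃗ : composition                 (f∘g⃗)(x⃗) = f(g₁(x⃗),…,g_m(x⃗))
--   Rec g h : primitive recursion         R(0,x⃗) = g(x⃗),
--                                         R(S y,x⃗) = h(y,R(y,x⃗),x⃗)

data PRF : ℕ → Set where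
  Z   : ∀ {n} → PRF n
  Sc  : PRF 1
  Pi  : ∀ {n} → Fin n → PRF n
  Cmp : ∀ {m n} → PRF m → Vec (PRF n) m → PRF n
  Rec : ∀ {n} → PRF n → PRF (suc (suc n)) → PRF (suc n)

-- Function symbols: PR symbols plus arbitrary further symbols F k of
-- arity k (the remaining function symbols a program may use).

data Sym (F : ℕ → Set) : ℕ → Set where
  pr  : ∀ {k} → PRF k → Sym F k
  ext : ∀ {k} → F k → Sym F k

-- Terms; variables are de Bruijn indices (var i is x_{i+1} when free).
data Tm (F : ℕ → Set) : Set where
  var : ℕ → Tm F
  𝟎   : Tm F
  𝐒   : Tm F → Tm F
  app : ∀ {k} → Sym F k → Vec (Tm F) k → Tm F

Eqn : (F : ℕ → Set) → Set
Eqn F = Tm F × Tm F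

Program : (F : ℕ → Set) → Set₁
Program F = Eqn F → Set

module _ {F : ℕ → Set} where

  vars : (n : ℕ) → Vec (Tm F) n
  vars n = tabulate (λ i → var (toℕ i))

  vars₁ : (n : ℕ) → Vec (Tm F) n
  vars₁ n = tabulate (λ i → var (suc (toℕ i)))

  data Def : ∀ {k} → PRF k → Eqn F → Set where
    defZ   : ∀ {n} → Def (Z {n}) (app (pr Z) (vars n) , 𝟎)
    defSc  : Def Sc (app (pr Sc) (var 0 ∷ []) , 𝐒 (var 0))
    defPi  : ∀ {n} (i : Fin n) →
             Def (Pi i) (app (pr (Pi i)) (vars n) , var (toℕ i))
    defCmp : ∀ {m n} (f : PRF m) (gs : Vec (PRF n) m) →
             Def (Cmp f gs)
               ( app (pr (Cmp f gs)) (vars n)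
               , app (pr f) (map (λ g → app (pr g) (vars n)) gs))
    defRec0 : ∀ {n} (g : PRF n) (h : PRF (suc (suc n))) →
             Def (Rec g h) (app (pr (Rec g h)) (𝟎 ∷ vars₁ n) , app (pr g) (vars₁ n))
    defRecS : ∀ {n} (g : PRF n) (h : PRF (suc (suc n))) →
             Def (Rec g h)
               ( app (pr (Rec g h)) (𝐒 (var 0) ∷ vars₁ n)
               , app (pr h) (var 0 ∷ app (pr (Rec g h)) (var 0 ∷ vars₁ n) ∷ vars₁ n))

  mutual
    data OccT {k} (f : PRF k) : Tm F → Set where
      here  : ∀ {ts} → OccT f (app (pr f) ts)
      inS   : ∀ {t} → OccT f t → OccT f (𝐒 t)
      inArg : ∀ {m} {g : Sym F m} {ts} → OccV f ts → OccT f (app g ts)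

    data OccV {k} (f : PRF k) : ∀ {m} → Vec (Tm F) m → Set where
      hd : ∀ {m t} {ts : Vec (Tm F) m} → OccT f t → OccV f (t ∷ ts)
      tl : ∀ {m t} {ts : Vec (Tm F) m} → OccV f ts → OccV f (t ∷ ts)

  OccE : ∀ {k} → PRF k → Eqn F → Set
  OccE f (l , r) = OccT f l ⊎ OccT f r

  Full : Program F → Set
  Full P = ∀ {k} (f : PRF k) (e : Eqn F) → P e → OccE f e →
           ∀ (d : Eqn F) → Def f d → P d

  -- t is in the language of P (as far as PR symbols are concerned).
  InLang : Program F → Tm F → Set
  InLang P t = ∀ {k} (f : PRF k) → OccT f t → Σ (Eqn F) (λ e → P e × OccE f e)

  mutual
    data IsPR : Tm F → Set where
      pvar : ∀ i → IsPR (var i)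
      p𝟎   : IsPR 𝟎
      p𝐒   : ∀ {t} → IsPR t → IsPR (𝐒 t)
      papp : ∀ {k} (f : PRF k) {ts} → AllPR ts → IsPR (app (pr f) ts)

    data AllPR : ∀ {m} → Vec (Tm F) m → Set where
      []  : AllPR []
      _∷_ : ∀ {m t} {ts : Vec (Tm F) m} → IsPR t → AllPR ts → AllPR (t ∷ ts)

  mutual
    data VarsBelow (n : ℕ) : Tm F → Set where
      vvar : ∀ {i} → i < n → VarsBelow n (var i)
      v𝟎   : VarsBelow n 𝟎
      v𝐒   : ∀ {t} → VarsBelow n t → VarsBelow n (𝐒 t)
      vapp : ∀ {k} {g : Sym F k} {ts} → VarsBelowV n ts → VarsBelow n (app g ts)

    data VarsBelowV (n : ℕ) : ∀ {m} → Vec (Tm F) m → Set where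
      []  : VarsBelowV n []
      _∷_ : ∀ {m t} {ts : Vec (Tm F) m} → VarsBelow n t → VarsBelowV n ts → VarsBelowV n (t ∷ ts)

  mutual
    subT : (ℕ → Tm F) → Tm F → Tm F
    subT σ (var x)    = σ x
    subT σ 𝟎          = 𝟎
    subT σ (𝐒 t)      = 𝐒 (subT σ t)
    subT σ (app f ts) = app f (subV σ ts)

    subV : ∀ {m} → (ℕ → Tm F) → Vec (Tm F) m → Vec (Tm F) m
    subV σ []       = []
    subV σ (t ∷ ts) = subT σ t ∷ subV σ ts

  wkT : Tm F → Tm F
  wkT = subT (λ x → var (suc x))

  mutual
    bound : Tm F → ℕ
    bound (var x)    = suc x
    bound 𝟎          = 0
    bound (𝐒 t)      = bound t
    bound (app f ts) = boundV ts

    boundV : ∀ {m} → Vec (Tm F) m → ℕ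
    boundV []       = 0
    boundV (t ∷ ts) = bound t ⊔ boundV ts

  infixr 5 _⇒_
  infixr 6 _∨_
  infixr 7 _∧_
  infix  8 _≐_
  data Fm : Set where
    _≐_ : Tm F → Tm F → Fm
    N   : Tm F → Fm
    ⊥'  : Fm
    _⇒_ : Fm → Fm → Fm
    _∧_ : Fm → Fm → Fm
    _∨_ : Fm → Fm → Fm
    ∀'  : Fm → Fm
    ∃'  : Fm → Fm

  ¬' : Fm → Fm
  ¬' A = A ⇒ ⊥'

  lift : (ℕ → Tm F) → ℕ → Tm F
  lift σ zero    = var 0
  lift σ (suc x) = wkT (σ x)

  subF : (ℕ → Tm F) → Fm → Fm
  subF σ (s ≐ t) = subT σ s ≐ subT σ t
  subF σ (N t)   = N (subT σ t)
  subF σ ⊥'      = ⊥'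
  subF σ (A ⇒ B) = subF σ A ⇒ subF σ B
  subF σ (A ∧ B) = subF σ A ∧ subF σ B
  subF σ (A ∨ B) = subF σ A ∨ subF σ B
  subF σ (∀' A)  = ∀' (subF (lift σ) A)
  subF σ (∃' A)  = ∃' (subF (lift σ) A)

  wkF : Fm → Fm
  wkF = subF (λ x → var (suc x))

  -- A [ t ] : substitute t for variable 0 (other variables shift down)
  sub0 : Tm F → ℕ → Tm F
  sub0 t zero    = t
  sub0 t (suc x) = var x

  infix 9 _[_]
  _[_] : Fm → Tm F → Fm
  A [ t ] = subF (sub0 t) A

  -- A[S x] for the bound variable x = var 0 (other variables untouched)
  succ0 : ℕ → Tm F
  succ0 zero    = 𝐒 (var 0)
  succ0 (suc x) = var (suc x)

  ∀ⁿ : ℕ → Fm → Fm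
  ∀ⁿ zero    A = A
  ∀ⁿ (suc k) A = ∀' (∀ⁿ k A)

  closure : Eqn F → Fm
  closure (l , r) = ∀ⁿ (bound l ⊔ bound r) (l ≐ r)

  infix 3 _⊢[_]_
  data _⊢[_]_ (Γ : List Fm) (P : Program F) : Fm → Set where
    hyp  : ∀ {A} → A ∈ Γ → Γ ⊢[ P ] A
    raa  : ∀ {A} → (¬' A ∷ₗ Γ) ⊢[ P ] ⊥' → Γ ⊢[ P ] A
    ⇒I   : ∀ {A B} → (A ∷ₗ Γ) ⊢[ P ] B → Γ ⊢[ P ] A ⇒ B
    ⇒E   : ∀ {A B} → Γ ⊢[ P ] A ⇒ B → Γ ⊢[ P ] A → Γ ⊢[ P ] B
    ∧I   : ∀ {A B} → Γ ⊢[ P ] A → Γ ⊢[ P ] B → Γ ⊢[ P ] A ∧ B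
    ∧E₁  : ∀ {A B} → Γ ⊢[ P ] A ∧ B → Γ ⊢[ P ] A
    ∧E₂  : ∀ {A B} → Γ ⊢[ P ] A ∧ B → Γ ⊢[ P ] B
    ∨I₁  : ∀ {A B} → Γ ⊢[ P ] A → Γ ⊢[ P ] A ∨ B
    ∨I₂  : ∀ {A B} → Γ ⊢[ P ] B → Γ ⊢[ P ] A ∨ B
    ∨E   : ∀ {A B C} → Γ ⊢[ P ] A ∨ B → (A ∷ₗ Γ) ⊢[ P ] C → (B ∷ₗ Γ) ⊢[ P ] C →
           Γ ⊢[ P ] C
    ∀I   : ∀ {A} → mapₗ wkF Γ ⊢[ P ] A → Γ ⊢[ P ] ∀' A
    ∀E   : ∀ {A} → Γ ⊢[ P ] ∀' A → (t : Tm F) → Γ ⊢[ P ] A [ t ]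
    ∃I   : ∀ {A} (t : Tm F) → Γ ⊢[ P ] A [ t ] → Γ ⊢[ P ] ∃' A
    ∃E   : ∀ {A C} → Γ ⊢[ P ] ∃' A → (A ∷ₗ mapₗ wkF Γ) ⊢[ P ] wkF C → Γ ⊢[ P ] C
    ≐refl  : ∀ {t} → Γ ⊢[ P ] t ≐ t
    ≐subst : ∀ {A s t} → Γ ⊢[ P ] s ≐ t → Γ ⊢[ P ] A [ s ] → Γ ⊢[ P ] A [ t ]
    sep₁ : Γ ⊢[ P ] ∀' (¬' (𝐒 (var 0) ≐ 𝟎))
    sep₂ : Γ ⊢[ P ] ∀' (∀' (𝐒 (var 1) ≐ 𝐒 (var 0) ⇒ var 1 ≐ var 0))
    prog : ∀ {e} → P e → Γ ⊢[ P ] closure e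
    N𝟎   : Γ ⊢[ P ] N 𝟎
    N𝐒   : ∀ {t} → Γ ⊢[ P ] N t → Γ ⊢[ P ] N (𝐒 t)
    Nind : ∀ {A t} → Γ ⊢[ P ] N t → Γ ⊢[ P ] A [ 𝟎 ] →
           Γ ⊢[ P ] ∀' (A ⇒ subF succ0 A) → Γ ⊢[ P ] A [ t ]

  -- hypotheses N(x₁), …, N(xₙ)  (x_{i+1} = var i)
  Nhyps : ℕ → List Fm
  Nhyps n = mapₗ (λ i → N (var i)) (upTo n)

module Submission where

-- Call a PR symbol f *total* if N(f(s⃗)) is derivable in every context
-- containing the hypotheses N(s₁), …, N(s_k).  By recursion on the code of
-- f, every PR symbol whose defining equations lie in P is total: Z, Sc and
-- Pi follow from their defining equation and the N rules; a composition
-- from totality of its components; a recursion R(y,x⃗) by the N-induction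
-- rule on y applied to the formula N(y) ∧ N(R(y,x⃗)).  Fullness of P
-- guarantees that the components of a symbol with equations in P again
-- have their equations in P.  The theorem then follows by induction on the
-- PR term, each symbol in it occurring in P by assumption.

open import Defs
open import Data.Nat using (ℕ; zero; suc; _⊔_; _<_; s≤s)
open import Data.Nat.Properties using (m≤m⊔n; m≤n⊔m; ≤-trans; ≤-refl)
open import Data.Fin using (Fin; toℕ; zero; suc)
open import Data.Vec using (Vec; []; _∷_; tabulate; map; lookup)
open import Data.Vec.Properties using (tabulate-cong; tabulate∘lookup)
open import Data.List using () renaming (_∷_ to _∷ₗ_; map to mapₗ)
open import Data.List.Membership.Propositional using (_∈_)
open import Data.List.Membership.Propositional.Properties using (∈-map⁺; ∈-upTo⁺)
open import Data.List.Relation.Binary.Subset.Propositional using (_⊆_)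
open import Data.List.Relation.Unary.Any using (here; there)
open import Data.Product using (Σ; _×_; _,_)
open import Data.Sum using (inj₂)
open import Function using (id; _∘_)
open import Relation.Binary.PropositionalEquality
  using (_≡_; refl; sym; trans; cong; cong₂; subst; subst₂)

module _ {F : ℕ → Set} where

  Sub : Set
  Sub = ℕ → Tm F

  _∘ₛ_ : Sub → Sub → Sub
  (σ ∘ₛ τ) x = subT σ (τ x)

  wk : Sub
  wk x = var (suc x)

  mutual
    subT-cong : {σ τ : Sub} → (∀ x → σ x ≡ τ x) → (t : Tm F) → subT σ t ≡ subT τ t
    subT-cong e (var x)    = e x
    subT-cong e 𝟎          = refl
    subT-cong e (𝐒 t)      = cong 𝐒 (subT-cong e t)
    subT-cong e (app f ts) = cong (app f) (subV-cong e ts)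

    subV-cong : ∀ {m} {σ τ : Sub} → (∀ x → σ x ≡ τ x) → (ts : Vec (Tm F) m) →
                subV σ ts ≡ subV τ ts
    subV-cong e []       = refl
    subV-cong e (t ∷ ts) = cong₂ _∷_ (subT-cong e t) (subV-cong e ts)

  mutual
    subT-comp : {σ τ : Sub} (t : Tm F) → subT σ (subT τ t) ≡ subT (σ ∘ₛ τ) t
    subT-comp (var x)    = refl
    subT-comp 𝟎          = refl
    subT-comp (𝐒 t)      = cong 𝐒 (subT-comp t)
    subT-comp (app f ts) = cong (app f) (subV-comp ts)

    subV-comp : ∀ {m} {σ τ : Sub} (ts : Vec (Tm F) m) →
                subV σ (subV τ ts) ≡ subV (σ ∘ₛ τ) ts
    subV-comp []       = refl
    subV-comp (t ∷ ts) = cong₂ _∷_ (subT-comp t) (subV-comp ts)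

  mutual
    subT-id : (t : Tm F) → subT var t ≡ t
    subT-id (var x)    = refl
    subT-id 𝟎          = refl
    subT-id (𝐒 t)      = cong 𝐒 (subT-id t)
    subT-id (app f ts) = cong (app f) (subV-id ts)

    subV-id : ∀ {m} (ts : Vec (Tm F) m) → subV var ts ≡ ts
    subV-id []       = refl
    subV-id (t ∷ ts) = cong₂ _∷_ (subT-id t) (subV-id ts)

  mutual
    subT-agree : {σ τ : Sub} (t : Tm F) → (∀ x → x < bound t → σ x ≡ τ x) →
                 subT σ t ≡ subT τ t
    subT-agree (var x)    e = e x ≤-refl
    subT-agree 𝟎          e = refl
    subT-agree (𝐒 t)      e = cong 𝐒 (subT-agree t e)
    subT-agree (app f ts) e = cong (app f) (subV-agree ts e)

    subV-agree : ∀ {m} {σ τ : Sub} (ts : Vec (Tm F) m) →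
                 (∀ x → x < boundV ts → σ x ≡ τ x) → subV σ ts ≡ subV τ ts
    subV-agree []       e = refl
    subV-agree (t ∷ ts) e =
      cong₂ _∷_ (subT-agree t (λ x h → e x (≤-trans h (m≤m⊔n _ _))))
                (subV-agree ts (λ x h → e x (≤-trans h (m≤n⊔m (bound t) _))))

  lift-cong : {σ τ : Sub} → (∀ x → σ x ≡ τ x) → ∀ x → lift σ x ≡ lift τ x
  lift-cong e zero    = refl
  lift-cong e (suc x) = cong wkT (e x)

  subF-cong : {σ τ : Sub} → (∀ x → σ x ≡ τ x) → (A : Fm {F}) → subF σ A ≡ subF τ A
  subF-cong e (s ≐ t) = cong₂ _≐_ (subT-cong e s) (subT-cong e t)
  subF-cong e (N t)   = cong N (subT-cong e t)
  subF-cong e ⊥'      = refl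
  subF-cong e (A ⇒ B) = cong₂ _⇒_ (subF-cong e A) (subF-cong e B)
  subF-cong e (A ∧ B) = cong₂ _∧_ (subF-cong e A) (subF-cong e B)
  subF-cong e (A ∨ B) = cong₂ _∨_ (subF-cong e A) (subF-cong e B)
  subF-cong e (∀' A)  = cong ∀' (subF-cong (lift-cong e) A)
  subF-cong e (∃' A)  = cong ∃' (subF-cong (lift-cong e) A)

  lift-comp : (σ τ : Sub) → ∀ x → (lift σ ∘ₛ lift τ) x ≡ lift (σ ∘ₛ τ) x
  lift-comp σ τ zero    = refl
  lift-comp σ τ (suc x) = trans (subT-comp (τ x)) (sym (subT-comp (τ x)))

  subF-comp : {σ τ : Sub} (A : Fm {F}) → subF σ (subF τ A) ≡ subF (σ ∘ₛ τ) A
  subF-comp (s ≐ t) = cong₂ _≐_ (subT-comp s) (subT-comp t)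
  subF-comp (N t)   = cong N (subT-comp t)
  subF-comp ⊥'      = refl
  subF-comp (A ⇒ B) = cong₂ _⇒_ (subF-comp A) (subF-comp B)
  subF-comp (A ∧ B) = cong₂ _∧_ (subF-comp A) (subF-comp B)
  subF-comp (A ∨ B) = cong₂ _∨_ (subF-comp A) (subF-comp B)
  subF-comp {σ} {τ} (∀' A) = cong ∀' (trans (subF-comp A) (subF-cong (lift-comp σ τ) A))
  subF-comp {σ} {τ} (∃' A) = cong ∃' (trans (subF-comp A) (subF-cong (lift-comp σ τ) A))

  lift-id : ∀ x → lift var x ≡ var {F} x
  lift-id zero    = refl
  lift-id (suc x) = refl

  subF-id : (A : Fm {F}) → subF var A ≡ A
  subF-id (s ≐ t) = cong₂ _≐_ (subT-id s) (subT-id t)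
  subF-id (N t)   = cong N (subT-id t)
  subF-id ⊥'      = refl
  subF-id (A ⇒ B) = cong₂ _⇒_ (subF-id A) (subF-id B)
  subF-id (A ∧ B) = cong₂ _∧_ (subF-id A) (subF-id B)
  subF-id (A ∨ B) = cong₂ _∨_ (subF-id A) (subF-id B)
  subF-id (∀' A)  = cong ∀' (trans (subF-cong lift-id A) (subF-id A))
  subF-id (∃' A)  = cong ∃' (trans (subF-cong lift-id A) (subF-id A))

  wk-sub0 : (u t : Tm F) → subT (sub0 u) (wkT t) ≡ t
  wk-sub0 u t = trans (subT-comp t) (subT-id t)

  wkV-sub0 : ∀ {m} (u : Tm F) (ts : Vec (Tm F) m) → subV (sub0 u) (subV wk ts) ≡ ts
  wkV-sub0 u ts = trans (subV-comp ts) (subV-id ts)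

  ∀ⁿ-suc : ∀ k (B : Fm {F}) → ∀ⁿ (suc k) B ≡ ∀ⁿ k (∀' B)
  ∀ⁿ-suc zero    B = refl
  ∀ⁿ-suc (suc k) B = cong ∀' (∀ⁿ-suc k B)

  cons : Tm F → Sub → Sub
  cons u σ zero    = u
  cons u σ (suc x) = σ x

  extR : ∀ {k} → Vec (Tm F) k → Sub → Sub
  extR []       σ = σ
  extR (u ∷ us) σ = cons u (extR us σ)

  extR-lookup : ∀ {k} (us : Vec (Tm F) k) (ρ : Sub) (i : Fin k) →
                extR us ρ (toℕ i) ≡ lookup us i
  extR-lookup (u ∷ us) ρ zero    = refl
  extR-lookup (u ∷ us) ρ (suc i) = extR-lookup us ρ i

  extR-tabulate : (σ : Sub) (k : ℕ) (ρ : Sub) → ∀ i → i < k →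
                  extR (tabulate {n = k} (σ ∘ toℕ)) ρ i ≡ σ i
  extR-tabulate σ (suc k) ρ zero    h       = refl
  extR-tabulate σ (suc k) ρ (suc i) (s≤s h) = extR-tabulate (σ ∘ suc) k ρ i h

  subV-tabulate : ∀ {n} (σ : Sub) (f : Fin n → Tm F) →
                  subV σ (tabulate f) ≡ tabulate (subT σ ∘ f)
  subV-tabulate {zero}  σ f = refl
  subV-tabulate {suc n} σ f = cong (subT σ (f zero) ∷_) (subV-tabulate σ (f ∘ suc))

  extR-vars : ∀ {n} (ss : Vec (Tm F) n) (ρ : Sub) → subV (extR ss ρ) (vars n) ≡ ss
  extR-vars ss ρ = trans (subV-tabulate _ _)
                         (trans (tabulate-cong (extR-lookup ss ρ)) (tabulate∘lookup ss))

  extR-vars₁ : ∀ {n} (s : Tm F) (ss : Vec (Tm F) n) (ρ : Sub) →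
               subV (extR (s ∷ ss) ρ) (vars₁ n) ≡ ss
  extR-vars₁ s ss ρ = trans (subV-tabulate _ _)
                            (trans (tabulate-cong (extR-lookup ss ρ)) (tabulate∘lookup ss))

  subV-lookup : ∀ {n} (σ : Sub) (ts : Vec (Tm F) n) (j : Fin n) →
                lookup (subV σ ts) j ≡ subT σ (lookup ts j)
  subV-lookup σ (t ∷ ts) zero    = refl
  subV-lookup σ (t ∷ ts) (suc j) = subV-lookup σ ts j

  compArgs : ∀ {m n} → Vec (PRF n) m → Vec (Tm F) n → Vec (Tm F) m
  compArgs gs vs = map (λ g → app (pr g) vs) gs

  subV-compArgs : ∀ {m n} (σ : Sub) (gs : Vec (PRF n) m) (vs : Vec (Tm F) n) →
                  subV σ (compArgs gs vs) ≡ compArgs gs (subV σ vs)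
  subV-compArgs σ []       vs = refl
  subV-compArgs σ (g ∷ gs) vs = cong (_ ∷_) (subV-compArgs σ gs vs)

  lookup-compArgs : ∀ {m n} (gs : Vec (PRF n) m) (vs : Vec (Tm F) n) (j : Fin m) →
                    lookup (compArgs gs vs) j ≡ app (pr (lookup gs j)) vs
  lookup-compArgs (g ∷ gs) vs zero    = refl
  lookup-compArgs (g ∷ gs) vs (suc j) = lookup-compArgs gs vs j

  occ-compArgs : ∀ {m n} (gs : Vec (PRF n) m) (vs : Vec (Tm F) n) (j : Fin m) →
                 OccV (lookup gs j) (compArgs gs vs)
  occ-compArgs (g ∷ gs) vs zero    = hd here
  occ-compArgs (g ∷ gs) vs (suc j) = tl (occ-compArgs gs vs j)

module _ {F : ℕ → Set} (P : Program F) where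

  instantiate : ∀ {Γ k} (B : Fm {F}) (us : Vec (Tm F) k) →
                Γ ⊢[ P ] ∀ⁿ k B → Γ ⊢[ P ] subF (extR us var) B
  instantiate {Γ} B [] d = subst (Γ ⊢[ P ]_) (sym (subF-id B)) d
  instantiate {Γ} {suc k} B (u ∷ us) d =
    subst (Γ ⊢[ P ]_) instance-eq
          (∀E (instantiate (∀' B) us (subst (Γ ⊢[ P ]_) (∀ⁿ-suc k B) d)) u)
    where
      ρ = extR us var
      instance-eq : subF (sub0 u) (subF (lift ρ) B) ≡ subF (cons u ρ) B
      instance-eq = trans (subF-comp B)
                          (subF-cong (λ { zero → refl ; (suc x) → wk-sub0 u (ρ x) }) B)

  equation-instance : ∀ {Γ l r l' r'} → P (l , r) → (σ : Sub) →
                      subT σ l ≡ l' → subT σ r ≡ r' → Γ ⊢[ P ] l' ≐ r'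
  equation-instance {Γ} {l} {r} p σ refl refl =
    subst₂ (λ a b → Γ ⊢[ P ] a ≐ b)
      (subT-agree l (λ x h → extR-tabulate σ k var x (≤-trans h (m≤m⊔n _ _))))
      (subT-agree r (λ x h → extR-tabulate σ k var x (≤-trans h (m≤n⊔m (bound l) _))))
      (instantiate (l ≐ r) (tabulate {n = k} (σ ∘ toℕ)) (prog p))
    where k = bound l ⊔ bound r

  ≐-sym : ∀ {Γ s t} → Γ ⊢[ P ] s ≐ t → Γ ⊢[ P ] t ≐ s
  ≐-sym {Γ} {s} {t} e =
    subst (λ z → Γ ⊢[ P ] t ≐ z) (wk-sub0 t s)
      (≐subst {A = var 0 ≐ wkT s} e
        (subst (λ z → Γ ⊢[ P ] s ≐ z) (sym (wk-sub0 s s)) ≐refl))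

  N-back : ∀ {Γ l r} → Γ ⊢[ P ] l ≐ r → Γ ⊢[ P ] N r → Γ ⊢[ P ] N l
  N-back e d = ≐subst {A = N (var 0)} (≐-sym e) d

  N⇒ : ∀ {k} → Vec (Tm F) k → Fm {F} → Fm {F}
  N⇒ []       C = C
  N⇒ (s ∷ ss) C = N s ⇒ N⇒ ss C

  N⇒-intro : ∀ {Γ k C} (ss : Vec (Tm F) k) →
             (∀ {Δ} → Γ ⊆ Δ → (∀ j → N (lookup ss j) ∈ Δ) → Δ ⊢[ P ] C) →
             Γ ⊢[ P ] N⇒ ss C
  N⇒-intro []       k = k id (λ ())
  N⇒-intro (s ∷ ss) k =
    ⇒I (N⇒-intro ss (λ ext mem →
      k (ext ∘ there) (λ { zero → ext (here refl) ; (suc j) → mem j })))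

  N⇒-elim : ∀ {Γ k C} (ss : Vec (Tm F) k) → Γ ⊢[ P ] N⇒ ss C →
            (∀ j → Γ ⊢[ P ] N (lookup ss j)) → Γ ⊢[ P ] C
  N⇒-elim []       d ds = d
  N⇒-elim (s ∷ ss) d ds = N⇒-elim ss (⇒E d (ds zero)) (ds ∘ suc)

  hypotheses-to-premises : ∀ {Γ k C} (ss : Vec (Tm F) k) →
    (∀ {Δ} → (∀ j → N (lookup ss j) ∈ Δ) → Δ ⊢[ P ] C) →
    (∀ j → Γ ⊢[ P ] N (lookup ss j)) → Γ ⊢[ P ] C
  hypotheses-to-premises ss k = N⇒-elim ss (N⇒-intro ss (λ _ → k))

  Defined : ∀ {k} → PRF k → Set
  Defined f = ∀ d → Def f d → P d

  Total : ∀ {k} → PRF k → Set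
  Total {k} f = ∀ {Γ} (ss : Vec (Tm F) k) → (∀ j → N (lookup ss j) ∈ Γ) →
                Γ ⊢[ P ] N (app (pr f) ss)

  total-premises : ∀ {k} {f : PRF k} → Total f → ∀ {Γ} (ss : Vec (Tm F) k) →
                   (∀ j → Γ ⊢[ P ] N (lookup ss j)) → Γ ⊢[ P ] N (app (pr f) ss)
  total-premises tot ss = hypotheses-to-premises ss (tot ss)

  total-Z : ∀ {n} → Defined (Z {n}) → Total Z
  total-Z def ss mem = N-back (equation-instance (def _ defZ) (extR ss var)
                                 (cong (app _) (extR-vars ss var)) refl) N𝟎

  total-Sc : Defined Sc → Total Sc
  total-Sc def (s ∷ []) mem =
    N-back (equation-instance (def _ defSc) (extR (s ∷ []) var) refl refl) (N𝐒 (hyp (mem zero)))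

  total-Pi : ∀ {n} (i : Fin n) → Defined (Pi i) → Total (Pi i)
  total-Pi i def ss mem =
    N-back (equation-instance (def _ (defPi i)) (extR ss var)
              (cong (app _) (extR-vars ss var)) (extR-lookup ss var i))
           (hyp (mem i))

  total-Cmp : ∀ {m n} (f : PRF m) (gs : Vec (PRF n) m) → Defined (Cmp f gs) →
              Total f → (∀ j → Total (lookup gs j)) → Total (Cmp f gs)
  total-Cmp f gs def tot-f tot-gs ss mem =
    N-back unfold (total-premises tot-f (compArgs gs ss) args-N)
    where
      unfold : _ ⊢[ P ] app (pr (Cmp f gs)) ss ≐ app (pr f) (compArgs gs ss)
      unfold = equation-instance (def _ (defCmp f gs)) (extR ss var)
                 (cong (app _) (extR-vars ss var))
                 (cong (app (pr f)) (trans (subV-compArgs _ gs (vars _))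
                                           (cong (compArgs gs) (extR-vars ss var))))
      args-N : ∀ j → _ ⊢[ P ] N (lookup (compArgs gs ss) j)
      args-N j = subst (λ z → _ ⊢[ P ] N z) (sym (lookup-compArgs gs ss j))
                       (tot-gs j ss mem)

  -- R(y,s⃗) is proved total by N-induction on y for A(y) = N(y) ∧ N(R(y,s⃗));
  -- the parameters s⃗ are weakened past the bound variable y.
  total-Rec : ∀ {n} (g : PRF n) (h : PRF (suc (suc n))) → Defined (Rec g h) →
              Total g → Total h → Total (Rec g h)
  total-Rec {n} g h def tot-g tot-h {Γ} (s₀ ∷ ss) mem =
    subst (λ v → Γ ⊢[ P ] N (app R (s₀ ∷ v))) (wkV-sub0 s₀ ss)
          (∧E₂ (Nind {A = A} (hyp (mem zero)) base (∀I (⇒I step))))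
    where
      R = pr (Rec g h)
      ws : Vec (Tm F) n
      ws = subV wk ss
      ws-succ0 : subV succ0 ws ≡ ws
      ws-succ0 = subV-comp ss
      A : Fm {F}
      A = N (var 0) ∧ N (app R (var 0 ∷ ws))
      base : Γ ⊢[ P ] A [ 𝟎 ]
      base = ∧I N𝟎 (subst (λ v → Γ ⊢[ P ] N (app R (𝟎 ∷ v))) (sym (wkV-sub0 𝟎 ss))
                      (N-back (equation-instance (def _ (defRec0 g h)) (extR (𝟎 ∷ ss) var)
                                 (cong (λ v → app R (𝟎 ∷ v)) (extR-vars₁ 𝟎 ss var))
                                 (cong (app (pr g)) (extR-vars₁ 𝟎 ss var)))
                              (tot-g ss (mem ∘ suc))))
      Θ = A ∷ₗ mapₗ wkF Γ
      h-args-N : ∀ j → Θ ⊢[ P ] N (lookup (var 0 ∷ app R (var 0 ∷ ws) ∷ ws) j)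
      h-args-N zero          = ∧E₁ (hyp (here refl))
      h-args-N (suc zero)    = ∧E₂ (hyp (here refl))
      h-args-N (suc (suc j)) =
        hyp (there (subst (λ z → N z ∈ mapₗ wkF Γ) (sym (subV-lookup wk ss j))
                          (∈-map⁺ wkF (mem (suc j)))))
      step : Θ ⊢[ P ] subF succ0 A
      step = ∧I (N𝐒 (∧E₁ (hyp (here refl))))
                (N-back (equation-instance (def _ (defRecS g h)) (extR (var 0 ∷ ws) var)
                           (cong (λ v → app R (𝐒 (var 0) ∷ v))
                                 (trans (extR-vars₁ (var 0) ws var) (sym ws-succ0)))
                           (cong (λ v → app (pr h) (var 0 ∷ app R (var 0 ∷ v) ∷ v))
                                 (extR-vars₁ (var 0) ws var)))
                        (total-premises tot-h _ h-args-N))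

  module _ (full : Full P) where

    -- Every PR symbol whose defining equations lie in P is total; fullness
    -- passes this hypothesis on to the symbols in its defining equations.
    mutual
      total : ∀ {k} (f : PRF k) → Defined f → Total f
      total Z          def = total-Z def
      total Sc         def = total-Sc def
      total (Pi i)     def = total-Pi i def
      total (Cmp f gs) def =
        total-Cmp f gs def (total f (full f _ eqn (inj₂ here)))
                  (totals gs (λ j → full (lookup gs j) _ eqn
                                       (inj₂ (inArg (occ-compArgs gs (vars _) j)))))
        where eqn = def _ (defCmp f gs)
      total (Rec g h)  def =
        total-Rec g h def (total g (full g _ (def _ (defRec0 g h)) (inj₂ here)))
                          (total h (full h _ (def _ (defRecS g h)) (inj₂ here)))

      totals : ∀ {m n} (gs : Vec (PRF n) m) → (∀ j → Defined (lookup gs j)) →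
               ∀ j → Total (lookup gs j)
      totals (g ∷ gs) def zero    = total g (def zero)
      totals (g ∷ gs) def (suc j) = totals gs (def ∘ suc) j

    mutual
      N-term : ∀ {Γ n t} → (∀ {i} → i < n → Γ ⊢[ P ] N (var i)) →
               IsPR t → VarsBelow n t → InLang P t → Γ ⊢[ P ] N t
      N-term Nvar (pvar i)     (vvar i<n) inL = Nvar i<n
      N-term Nvar p𝟎           _          inL = N𝟎
      N-term Nvar (p𝐒 p)       (v𝐒 v)     inL = N𝐒 (N-term Nvar p v (λ f o → inL f (inS o)))
      N-term Nvar (papp f {ts} ps) (vapp vs) inL with inL f here
      ... | (e , pe , occ) =
        total-premises (total f (full f e pe occ)) ts
          (N-terms Nvar ps vs (λ f o → inL f (inArg o)))

      N-terms : ∀ {Γ n m} {ts : Vec (Tm F) m} → (∀ {i} → i < n → Γ ⊢[ P ] N (var i)) →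
                AllPR ts → VarsBelowV n ts →
                (∀ {k} (f : PRF k) → OccV f ts → Σ (Eqn F) (λ e → P e × OccE f e)) →
                ∀ j → Γ ⊢[ P ] N (lookup ts j)
      N-terms Nvar (p ∷ ps) (v ∷ vs) inL zero    = N-term Nvar p v (λ f o → inL f (hd o))
      N-terms Nvar (p ∷ ps) (v ∷ vs) inL (suc j) = N-terms Nvar ps vs (λ f o → inL f (tl o)) j

lemma6 : {F : ℕ → Set} (P : Program F) → Full P →
         (n : ℕ) (t : Tm F) → IsPR t → VarsBelow n t → InLang P t →
         Nhyps n ⊢[ P ] N t
lemma6 P full n t =
  N-term P full (λ i<n → hyp (∈-map⁺ (λ i → N (var i)) (∈-upTo⁺ i<n)))
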